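{- Let $q\ge2$, let $G$ be a rooted bipartite $(q+1)$-edge-colored graph and $S=\Psi(G)$, and let $c\in\{1,\dots,q\}$ be such that $S_{\hat c}$ is a forest (every connected component is a tree). Then every connected component of the graph obtained from $G$ by deleting all edges of colors $0$ and $c$ is a melonic $(q-1)$-colored graph.
   Context: A $(q+1)$-edge-colored graph is a finite connected multigraph with edge colors in $\{0,\dots,q\}$, each vertex incident to exactly one edge of each color; rooted = one color-$0$ edge distinguished and oriented; bipartite = vertices black/white with every edge joining black to white. A $q$-constellation is a connected graph with white vertices, each of degree $q$ with one incident edge of each color $1,\dots,q$, and colored vertices, each carrying a color $i\in\{1,\dots,q\}$ and a cyclic order of its incident edges; each edge has a color $i$ and joins a white vertex to a color-$i$ vertex; one white vertex is the root. $\Psi$: orient all edges of $G$ black to white; contract every color-$0$ edge into a white vertex (root edge giving the root); for each $i$ the color-$i$ edges form disjoint directed cycles; replace each cycle on $p$ vertices by a new color-$i$ vertex joined by color-$i$ edges to these $p$ vertices in the cyclic order of the cycle. $S_{\hat c}$ is obtained from $S$ by deleting all edges and vertices of color $c$. For a finite set $A$ of $k$ colors, a $k$-colored graph is a connected multigraph with edge colors in $A$, each vertex incident to exactly one edge of each color. Melonic $k$-colored graphs: starting from the graph with two vertices joined by $k$ edges (one of each color), repeatedly choose an edge of some color $a$ joining $u$ and $v$, delete it, add two new vertices $x,y$ joined by $k-1$ edges carrying all colors of $A$ other than $a$, and add color-$a$ edges $ux$ and $yv$; the graphs so obtained are melonic. -}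

module Defs where

open import Data.Nat using (ℕ; zero; suc; _≤_; _+_)
open import Data.Fin using (Fin; zero; suc; fromℕ; inject₁)
open import Data.Fin.Properties renaming (_≟_ to _≟F_)
open import Data.Bool using (Bool; true; false; not; _∧_; if_then_else_; T)
open import Data.Bool.Properties using (T-irrelevant)
open import Data.Product using (Σ; ∃; _×_; _,_; proj₁)
open import Data.Unit using (⊤)
open import Data.Empty using (⊥)
open import Relation.Nullary using (¬_; yes; no; does)
open import Relation.Binary.PropositionalEquality using (_≡_; _≢_; refl; cong)
open import Relation.Binary.Definitions using (DecidableEquality)
open import Function.Definitions using (Injective)
open import Function.Bundles using (_⇔_)

iter : {A : Set} → (A → A) → ℕ → A → A
iter f zero    x = x
iter f (suc k) x = f (iter f k x)

-- A graph in which every vertex has exactly one edge of each color of C is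
-- encoded by its vertex set Fin n and, for each color a, the map σ a sending a
-- vertex to the other endpoint of its a-colored edge.
data Reach {C : Set} {n : ℕ} (σ : C → Fin n → Fin n) (P : C → Set) (u : Fin n)
           : Fin n → Set where
  here : Reach σ P u u
  step : ∀ {v} (a : C) → P a → Reach σ P u v → Reach σ P u (σ a v)

record ColGraph (q : ℕ) : Set where
  field
    n         : ℕ
    σ         : Fin (suc q) → Fin n → Fin n
    invol     : ∀ i v → σ i (σ i v) ≡ v
    loopless  : ∀ i v → σ i v ≢ v
    connected : ∀ u v → Reach σ (λ _ → ⊤) u v

IsBipartite : ∀ {q} (G : ColGraph q) → (Fin (ColGraph.n G) → Bool) → Set
IsBipartite G black = ∀ i v → black (ColGraph.σ G i v) ≡ not (black v)

module Constellation {q : ℕ} (G : ColGraph q) (black : Fin (ColGraph.n G) → Bool) where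
  open ColGraph G

  -- White vertices of S are the color-0 edges of G, indexed by their black endpoint.
  -- After orienting black→white and contracting color-0 edges, the color-i edge
  -- leaving (the contraction of) black b enters the contraction of σ 0 (σ i b).
  π : Fin (suc q) → Fin n → Fin n
  π i b = σ zero (σ i b)

  -- b and b' lie on the same directed color-i cycle, i.e. the same color-i vertex of S
  SameCycle : Fin (suc q) → Fin n → Fin n → Set
  SameCycle i b b' = ∃ λ k → iter (π i) k b ≡ b'

  -- vertices of S_ĉ: white vertices, and colored vertices of color i ∉ {0, c}
  -- (a colored vertex of color i is represented by any black vertex on its cycle)
  data SVert (c : Fin (suc q)) : Set where
    wv : (b : Fin n) → black b ≡ true → SVert c
    cv : (i : Fin (suc q)) → i ≢ zero → i ≢ c → (b : Fin n) → black b ≡ true → SVert c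

  SEq : ∀ {c} → SVert c → SVert c → Set
  SEq (wv b _)         (wv b' _)          = b ≡ b'
  SEq (wv _ _)         (cv _ _ _ _ _)     = ⊥
  SEq (cv _ _ _ _ _)   (wv _ _)           = ⊥
  SEq (cv i _ _ b _)   (cv i' _ _ b' _)   = i ≡ i' × SameCycle i b b'

  SAdj : ∀ {c} → SVert c → SVert c → Set
  SAdj (wv _ _)         (wv _ _)          = ⊥
  SAdj (wv b _)         (cv i _ _ b' _)   = SameCycle i b b'
  SAdj (cv i _ _ b' _)  (wv b _)          = SameCycle i b b'
  SAdj (cv _ _ _ _ _)   (cv _ _ _ _ _)    = ⊥

  record SCycle (c : Fin (suc q)) (m : ℕ) : Set where
    field
      vtx      : Fin (3 + m) → SVert c
      distinct : ∀ j k → SEq (vtx j) (vtx k) → j ≡ k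
      adj      : ∀ (j : Fin (2 + m)) → SAdj (vtx (inject₁ j)) (vtx (suc j))
      close    : SAdj (vtx (fromℕ (2 + m))) (vtx zero)

  IsForest : Fin (suc q) → Set
  IsForest c = ∀ m → ¬ SCycle c m

module Melonic {C : Set} (_≟C_ : DecidableEquality C) where

  swap2 : Fin 2 → Fin 2
  swap2 zero       = suc zero
  swap2 (suc zero) = zero

  -- Insertion on the a-colored edge {u, σ a u}: new vertices x = 0, y = 1 (old
  -- vertex w becomes suc (suc w)); x,y joined by all colors ≠ a; a-edges u–x, y–(σ a u).
  insert : ∀ {n} → (C → Fin n → Fin n) → C → Fin n
         → C → Fin (suc (suc n)) → Fin (suc (suc n))
  insert σ a u b zero       = if does (b ≟C a) then suc (suc u) else suc zero
  insert σ a u b (suc zero) = if does (b ≟C a) then suc (suc (σ a u)) else zero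
  insert σ a u b (suc (suc w)) =
    if does (b ≟C a)
      then (if does (w ≟F u) then zero
            else if does (w ≟F σ a u) then suc zero
            else suc (suc (σ a w)))
      else suc (suc (σ b w))

  data Built : (n : ℕ) → (C → Fin n → Fin n) → Set where
    base : Built 2 (λ _ → swap2)
    grow : ∀ {n σ} → Built n σ → (a : C) (u : Fin n) → Built (suc (suc n)) (insert σ a u)

okCol : ∀ {q} → Fin (suc q) → Fin (suc q) → Bool
okCol c zero    = false
okCol c (suc i) = not (does (suc i ≟F c))

ColA : (q : ℕ) → Fin (suc q) → Set
ColA q c = Σ (Fin (suc q)) (λ i → T (okCol c i))

_≟A_ : ∀ {q c} → DecidableEquality (ColA q c)
(i , p) ≟A (j , r) with i ≟F j
... | no i≢j = no λ { refl → i≢j refl }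
... | yes refl with T-irrelevant p r
... | refl = yes refl

-- The connected component of v in G with colors 0 and c deleted is a melonic
-- (q-1)-colored graph (color set ColA q c): it is isomorphic (via an injective,
-- color-preserving map f whose image is exactly the component) to a graph
-- produced by the melonic construction.
ComponentMelonic : ∀ {q} (G : ColGraph q) (c : Fin (suc q)) → Fin (ColGraph.n G) → Set
ComponentMelonic {q} G c v =
  Σ ℕ λ m → Σ (ColA q c → Fin m → Fin m) λ σ₀ → Melonic.Built (_≟A_ {q} {c}) m σ₀ ×
  Σ (Fin m → Fin (ColGraph.n G)) λ f → Injective _≡_ _≡_ f ×
    (∀ (a : ColA q c) w → f (σ₀ a w) ≡ ColGraph.σ G (proj₁ a) (f w)) ×
    (∀ u → Reach (ColGraph.σ G) (λ i → T (okCol c i)) v u ⇔ (∃ λ w → f w ≡ u))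

-- A black vertex is active if it lies on a nontrivial cycle of Ψ(G) of some colour in
-- A = {1, …, q} ∖ {c}. Without active vertices every colour of A joins each vertex to its
-- colour-0 neighbour, so all components are two-vertex melons. Otherwise, follow a walk in S_ĉ
-- that always leaves a white vertex through a new colour with a nontrivial cycle: since S_ĉ is
-- a forest it cannot go on forever, and it gets stuck at the white vertex of a colour-0 edge
-- {b, w} whose only non-leaf neighbour has colour a. Then b and w are joined by every colour of
-- A but a, i.e. {b, w} is a melon inserted on an a-edge. Removing it (joining σ_a b to σ_a w)
-- preserves the hypotheses and makes b inactive; by induction the components of the smaller
-- graph are melonic, and reinserting {b, w} gives the components of G.
module Submission where

open import Defs
open import Data.Nat using (ℕ; zero; suc; _+_; _*_; _≤_; _<_; s≤s; _⊓_; ⌊_/2⌋; ⌈_/2⌉; parity)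
open import Data.Parity using (Parity; 0ℙ; 1ℙ)
import Data.Parity.Properties as ℙ
import Data.Nat.Properties as ℕ
open import Data.Nat.Induction using (<-wellFounded)
open import Induction.WellFounded using (Acc; acc)
open import Data.Nat.DivMod using (_%_; _/_; m≡m%n+[m/n]*n; m%n<n)
open import Data.Fin using (Fin; zero; suc; toℕ; fromℕ; fromℕ<; inject₁)
open import Data.Fin.Properties
  using (pigeonhole; any?; toℕ-fromℕ<; toℕ-fromℕ; toℕ-inject₁; toℕ-injective; toℕ<n)
  renaming (_≟_ to _≟F_)
open import Data.Bool using (Bool; true; not; T)
open import Data.Bool.Properties using (T-irrelevant; not-involutive; not-¬; ¬-not; T-≡) renaming (_≟_ to _≟B_)
open import Data.Vec using (tabulate)
open import Data.Vec.Properties using (lookup∘tabulate; lookup⇒[]=; []=⇒lookup)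
open import Data.Fin.Subset using (Subset; _∈_; ∣_∣)
open import Data.Fin.Subset.Properties using (p⊂q⇒∣p∣<∣q∣)
open import Data.Unit using (tt)
open import Data.Empty using (⊥-elim)
open import Data.Product using (Σ; ∃; _×_; _,_; proj₁; proj₂)
open import Data.Sum using (_⊎_; inj₁; inj₂; [_,_])
open import Relation.Nullary using (¬_; yes; no; Dec)
open import Relation.Nullary.Decidable using (T?; _×-dec_; _⊎-dec_; ¬?; decidable-stable; isYes; fromWitness; toWitness)
open import Relation.Binary.PropositionalEquality
  using (_≡_; _≢_; refl; sym; trans; cong; cong₂; subst; subst₂; module ≡-Reasoning)
open import Relation.Binary.Definitions using (tri<; tri≈; tri>)
open import Function.Definitions using (Injective)
open import Function.Bundles using (_⇔_; mk⇔; Equivalence)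

module Orbits {n : ℕ} (f : Fin n → Fin n) (f-injective : Injective _≡_ _≡_ f) where

  Orbit : Fin n → Fin n → Set
  Orbit x y = ∃ λ k → iter f k x ≡ y

  iter-+ : ∀ k l x → iter f (k + l) x ≡ iter f k (iter f l x)
  iter-+ zero    l x = refl
  iter-+ (suc k) l x = cong f (iter-+ k l x)

  iter-injective : ∀ k → Injective _≡_ _≡_ (iter f k)
  iter-injective zero    eq = eq
  iter-injective (suc k) eq = iter-injective k (f-injective eq)

  iter-period : ∀ x → ∃ λ p → iter f (suc p) x ≡ x
  iter-period x with pigeonhole (ℕ.n<1+n n) (λ k → iter f (toℕ k) x)
  ... | i , j , i<j , eq with ℕ.m≤n⇒∃[o]m+o≡n i<j
  ... | p , i+1+p≡j = p , iter-injective (toℕ i) (begin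
    iter f (toℕ i) (iter f (suc p) x) ≡⟨ iter-+ (toℕ i) (suc p) x ⟨
    iter f (toℕ i + suc p) x          ≡⟨ cong (λ k → iter f k x) (trans (ℕ.+-suc (toℕ i) p) i+1+p≡j) ⟩
    iter f (toℕ j) x                  ≡⟨ eq ⟨
    iter f (toℕ i) x                  ∎)
    where open ≡-Reasoning

  module _ {x : Fin n} {p : ℕ} (period : iter f (suc p) x ≡ x) where

    iter-*-period : ∀ m → iter f (m * suc p) x ≡ x
    iter-*-period zero    = refl
    iter-*-period (suc m) = begin
      iter f (suc p + m * suc p) x          ≡⟨ iter-+ (suc p) (m * suc p) x ⟩
      iter f (suc p) (iter f (m * suc p) x) ≡⟨ cong (iter f (suc p)) (iter-*-period m) ⟩
      iter f (suc p) x                      ≡⟨ period ⟩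
      x                                     ∎
      where open ≡-Reasoning

    iter-%-period : ∀ k → iter f k x ≡ iter f (k % suc p) x
    iter-%-period k = begin
      iter f k x                                           ≡⟨ cong (λ l → iter f l x) (m≡m%n+[m/n]*n k (suc p)) ⟩
      iter f (k % suc p + k / suc p * suc p) x             ≡⟨ iter-+ (k % suc p) _ x ⟩
      iter f (k % suc p) (iter f (k / suc p * suc p) x)    ≡⟨ cong (iter f (k % suc p)) (iter-*-period (k / suc p)) ⟩
      iter f (k % suc p) x                                 ∎
      where open ≡-Reasoning

  orbit-sym : ∀ {x y} → Orbit x y → Orbit y x
  orbit-sym {x} {y} (k , refl) with iter-period x
  ... | p , period = k * p , (begin
    iter f (k * p) (iter f k x) ≡⟨ iter-+ (k * p) k x ⟨
    iter f (k * p + k) x        ≡⟨ cong (λ l → iter f l x) (trans (ℕ.+-comm (k * p) k) (sym (ℕ.*-suc k p))) ⟩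
    iter f (k * suc p) x        ≡⟨ iter-*-period period k ⟩
    x                           ∎)
    where open ≡-Reasoning

  orbit-trans : ∀ {x y z} → Orbit x y → Orbit y z → Orbit x z
  orbit-trans {x} (k , refl) (l , refl) = l + k , iter-+ l k x

  orbit? : ∀ x y → Dec (Orbit x y)
  orbit? x y with iter-period x
  ... | p , period with any? {P = λ (k : Fin (suc p)) → iter f (toℕ k) x ≡ y} (λ k → iter f (toℕ k) x ≟F y)
  ... | yes (k , e) = yes (toℕ k , e)
  ... | no none = no λ { (k , e) → none (fromℕ< (m%n<n k (suc p)) ,
          trans (cong (λ l → iter f l x) (toℕ-fromℕ< (m%n<n k (suc p))))
                (trans (sym (iter-%-period period k)) e)) }

module RepetitionCycle {X : Set} (_≈_ Adj : X → X → Set) (_≈?_ : ∀ x y → Dec (x ≈ y))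
  (≈-sym : ∀ {x y} → x ≈ y → y ≈ x) (Adj-resp-≈ : ∀ {x y z} → Adj x y → y ≈ z → Adj x z) where

  record Cycle (m : ℕ) : Set where
    field
      vtx      : Fin (3 + m) → X
      distinct : ∀ j k → vtx j ≈ vtx k → j ≡ k
      adj      : ∀ (j : Fin (2 + m)) → Adj (vtx (inject₁ j)) (vtx (suc j))
      close    : Adj (vtx (fromℕ (2 + m))) (vtx zero)

  module _ (u : ℕ → X) (L : ℕ)
           (adjacent : ∀ r → r < L → Adj (u r) (u (suc r)))
           (no-stay : ∀ r → ¬ u r ≈ u (suc r))
           (no-backtrack : ∀ r → r < L → ¬ u r ≈ u (suc (suc r))) where

    RepeatAt : ℕ → Set
    RepeatAt t = ∃ λ s → s < t × u s ≈ u t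

    FirstRepeatAt : ℕ → Set
    FirstRepeatAt t = RepeatAt t × (∀ {t′} → t′ < t → ¬ RepeatAt t′)

    repeatAt? : ∀ t → Dec (RepeatAt t)
    repeatAt? t = ℕ.anyUpTo? (λ s → u s ≈? u t) t

    firstRepeat : ∀ {t} → RepeatAt t → ∃ λ t₁ → t₁ ≤ t × FirstRepeatAt t₁
    firstRepeat {t} = go t (<-wellFounded t)
      where
      go : ∀ t → Acc _<_ t → RepeatAt t → ∃ λ t₁ → t₁ ≤ t × FirstRepeatAt t₁
      go t (acc earlier) rep with ℕ.anyUpTo? repeatAt? t
      ... | yes (t′ , t′<t , rep′) =
        let t₁ , t₁≤t′ , first = go t′ (earlier t′<t) rep′ in t₁ , ℕ.≤-trans t₁≤t′ (ℕ.<⇒≤ t′<t) , first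
      ... | no none = t , ℕ.≤-refl , rep , λ t′<t rep′ → none (_ , t′<t , rep′)

    -- A first repetition u s ≈ u (s + 3 + m) has u s, …, u (s + 2 + m) pairwise inequivalent.
    windowCycle : ∀ s m → suc s + suc (suc m) ≤ L → u s ≈ u (suc s + suc (suc m))
                → (∀ {t′} → t′ < suc s + suc (suc m) → ¬ RepeatAt t′) → Cycle m
    windowCycle s m t₁≤L rep first = record
      { vtx = vtx ; distinct = distinct ; adj = adj ; close = close }
      where
      vtx : Fin (3 + m) → X
      vtx k = u (s + toℕ k)

      s+3+m≤L : s + (3 + m) ≤ L
      s+3+m≤L = ℕ.≤-trans (ℕ.≤-reflexive (ℕ.+-suc s (2 + m))) t₁≤L

      ordered : ∀ j k → toℕ j < toℕ k → ¬ vtx j ≈ vtx k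
      ordered j k j<k eq =
        first (ℕ.<-≤-trans (ℕ.+-monoʳ-< s (toℕ<n k)) (ℕ.≤-reflexive (ℕ.+-suc s (2 + m))))
              (s + toℕ j , ℕ.+-monoʳ-< s j<k , eq)

      distinct : ∀ j k → vtx j ≈ vtx k → j ≡ k
      distinct j k eq with ℕ.<-cmp (toℕ j) (toℕ k)
      ... | tri< j<k _ _ = ⊥-elim (ordered j k j<k eq)
      ... | tri≈ _ j≡k _ = toℕ-injective j≡k
      ... | tri> _ _ k<j = ⊥-elim (ordered k j k<j (≈-sym eq))

      inRange : ∀ {k} → k < 3 + m → s + k < L
      inRange k<3+m = ℕ.<-≤-trans (ℕ.+-monoʳ-< s k<3+m) s+3+m≤L

      adj : ∀ (j : Fin (2 + m)) → Adj (vtx (inject₁ j)) (vtx (suc j))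
      adj j rewrite toℕ-inject₁ j | ℕ.+-suc s (toℕ j) = adjacent (s + toℕ j) (inRange (ℕ.m<n⇒m<1+n (toℕ<n j)))

      close : Adj (vtx (fromℕ (2 + m))) (vtx zero)
      close rewrite toℕ-fromℕ (2 + m) | ℕ.+-identityʳ s =
        Adj-resp-≈ (adjacent (s + suc (suc m)) (inRange (ℕ.n<1+n (2 + m)))) (≈-sym rep)

    repeat⇒cycle : ∀ {s t} → s < t → t ≤ L → u s ≈ u t → ∃ Cycle
    repeat⇒cycle s<t t≤L rep with firstRepeat (_ , s<t , rep)
    ... | t₁ , t₁≤t , (s₁ , s₁<t₁ , rep₁) , first with ℕ.m≤n⇒∃[o]m+o≡n s₁<t₁
    ... | zero , refl = ⊥-elim (no-stay s₁ (subst (λ t → u s₁ ≈ u t) (ℕ.+-identityʳ (suc s₁)) rep₁))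
    ... | suc zero , refl = ⊥-elim (no-backtrack s₁ (ℕ.<-≤-trans s₁<t₁ (ℕ.≤-trans t₁≤t t≤L))
                                  (subst (λ t → u s₁ ≈ u t) (cong suc (ℕ.+-comm s₁ 1)) rep₁))
    ... | suc (suc m) , refl = m , windowCycle s₁ m (ℕ.≤-trans t₁≤t t≤L) rep₁ first

module Rewire {n : ℕ} (τ : Fin n → Fin n) (τ-invol : ∀ v → τ (τ v) ≡ v) (x y : Fin n)
              (x≢y : x ≢ y) (x≢τx : x ≢ τ x) (y≢τy : y ≢ τ y) (x≢τy : x ≢ τ y) where

  Other : Fin n → Set
  Other v = v ≢ x × v ≢ y × v ≢ τ x × v ≢ τ y

  data Case (v : Fin n) : Set where
    is-x  : v ≡ x → Case v
    is-y  : v ≡ y → Case v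
    is-τx : v ≡ τ x → Case v
    is-τy : v ≡ τ y → Case v
    other : Other v → Case v

  case : ∀ v → Case v
  case v with v ≟F x | v ≟F y | v ≟F τ x | v ≟F τ y
  ... | yes v≡x | _       | _        | _        = is-x v≡x
  ... | no v≢x  | yes v≡y | _        | _        = is-y v≡y
  ... | no v≢x  | no v≢y  | yes v≡τx | _        = is-τx v≡τx
  ... | no v≢x  | no v≢y  | no v≢τx  | yes v≡τy = is-τy v≡τy
  ... | no v≢x  | no v≢y  | no v≢τx  | no v≢τy  = other (v≢x , v≢y , v≢τx , v≢τy)

  rewire : Fin n → Fin n
  rewire v with case v
  ... | is-x _  = y
  ... | is-y _  = x
  ... | is-τx _ = τ y
  ... | is-τy _ = τ x
  ... | other _ = τ v

  τx≢τy : τ x ≢ τ y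
  τx≢τy eq = x≢y (trans (sym (τ-invol x)) (trans (cong τ eq) (τ-invol y)))

  y≢τx : y ≢ τ x
  y≢τx eq = x≢τy (trans (sym (τ-invol x)) (cong τ (sym eq)))

  rewire-x : rewire x ≡ y
  rewire-x with case x
  ... | is-x _                = refl
  ... | is-y x≡y              = ⊥-elim (x≢y x≡y)
  ... | is-τx x≡τx            = ⊥-elim (x≢τx x≡τx)
  ... | is-τy x≡τy            = ⊥-elim (x≢τy x≡τy)
  ... | other (x≢x , _)       = ⊥-elim (x≢x refl)

  rewire-y : rewire y ≡ x
  rewire-y with case y
  ... | is-x y≡x              = ⊥-elim (x≢y (sym y≡x))
  ... | is-y _                = refl
  ... | is-τx y≡τx            = ⊥-elim (y≢τx y≡τx)
  ... | is-τy y≡τy            = ⊥-elim (y≢τy y≡τy)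
  ... | other (_ , y≢y , _)   = ⊥-elim (y≢y refl)

  rewire-τx : rewire (τ x) ≡ τ y
  rewire-τx with case (τ x)
  ... | is-x τx≡x             = ⊥-elim (x≢τx (sym τx≡x))
  ... | is-y τx≡y             = ⊥-elim (y≢τx (sym τx≡y))
  ... | is-τx _               = refl
  ... | is-τy τx≡τy           = ⊥-elim (τx≢τy τx≡τy)
  ... | other (_ , _ , τx≢τx , _) = ⊥-elim (τx≢τx refl)

  rewire-τy : rewire (τ y) ≡ τ x
  rewire-τy with case (τ y)
  ... | is-x τy≡x             = ⊥-elim (x≢τy (sym τy≡x))
  ... | is-y τy≡y             = ⊥-elim (y≢τy (sym τy≡y))
  ... | is-τx τy≡τx           = ⊥-elim (τx≢τy (sym τy≡τx))
  ... | is-τy _               = refl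
  ... | other (_ , _ , _ , τy≢τy) = ⊥-elim (τy≢τy refl)

  rewire-other : ∀ {v} → Other v → rewire v ≡ τ v
  rewire-other {v} (v≢x , v≢y , v≢τx , v≢τy) with case v
  ... | is-x v≡x   = ⊥-elim (v≢x v≡x)
  ... | is-y v≡y   = ⊥-elim (v≢y v≡y)
  ... | is-τx v≡τx = ⊥-elim (v≢τx v≡τx)
  ... | is-τy v≡τy = ⊥-elim (v≢τy v≡τy)
  ... | other _    = refl

  τ-other : ∀ {v} → Other v → Other (τ v)
  τ-other {v} (v≢x , v≢y , v≢τx , v≢τy) =
    (λ eq → v≢τx (trans (sym (τ-invol v)) (cong τ eq))) ,
    (λ eq → v≢τy (trans (sym (τ-invol v)) (cong τ eq))) ,
    (λ eq → v≢x (trans (sym (τ-invol v)) (trans (cong τ eq) (τ-invol x)))) ,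
    (λ eq → v≢y (trans (sym (τ-invol v)) (trans (cong τ eq) (τ-invol y))))

  rewire-invol : ∀ v → rewire (rewire v) ≡ v
  rewire-invol v with case v
  ... | is-x v≡x   = trans rewire-y (sym v≡x)
  ... | is-y v≡y   = trans rewire-x (sym v≡y)
  ... | is-τx v≡τx = trans rewire-τy (sym v≡τx)
  ... | is-τy v≡τy = trans rewire-τx (sym v≡τy)
  ... | other o    = trans (rewire-other (τ-other o)) (τ-invol v)

  module _ (black : Fin n → Bool) (τ-flips : ∀ v → black (τ v) ≡ not (black v)) where

    private
      opposite-sym : ∀ {u v} → black u ≡ not (black v) → black v ≡ not (black u)
      opposite-sym {u} {v} eq = trans (sym (not-involutive (black v))) (cong not (sym eq))

      τ-opposite : ∀ {u v} → black u ≡ not (black v) → black (τ u) ≡ not (black (τ v))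
      τ-opposite {u} {v} eq = trans (τ-flips u) (trans (cong not eq) (cong not (sym (τ-flips v))))

    rewire-flips : black y ≡ not (black x) → ∀ v → black (rewire v) ≡ not (black v)
    rewire-flips y-flips v with case v
    ... | is-x refl  = y-flips
    ... | is-y refl  = opposite-sym y-flips
    ... | is-τx refl = τ-opposite y-flips
    ... | is-τy refl = τ-opposite (opposite-sym y-flips)
    ... | other _    = τ-flips v

parity-⌊/2⌋-suc : ∀ r → (parity r ≡ 0ℙ × parity (suc r) ≡ 1ℙ × ⌊ suc r /2⌋ ≡ ⌊ r /2⌋)
                      ⊎ (parity r ≡ 1ℙ × parity (suc r) ≡ 0ℙ × ⌊ suc r /2⌋ ≡ suc ⌊ r /2⌋)
parity-⌊/2⌋-suc zero          = inj₁ (refl , refl , refl)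
parity-⌊/2⌋-suc (suc zero)    = inj₂ (refl , refl , refl)
parity-⌊/2⌋-suc (suc (suc r)) with parity-⌊/2⌋-suc r
... | inj₁ (p , p′ , h) = inj₁ (p , p′ , cong suc h)
... | inj₂ (p , p′ , h) = inj₂ (p , p′ , cong suc h)

parity-double : ∀ t → parity (t + t) ≡ 0ℙ
parity-double t = trans (ℙ.+-homo-+ t t) (ℙ.p+p≡0ℙ (parity t))

⌊/2⌋<-double : ∀ {r n} → r < n + n → ⌊ r /2⌋ < n
⌊/2⌋<-double {r} {n} r<n+n = ℕ.≰⇒> λ n≤h → ℕ.<-irrefl refl (begin-strict
  n + n                 ≤⟨ ℕ.+-mono-≤ n≤h n≤h ⟩
  ⌊ r /2⌋ + ⌊ r /2⌋     ≤⟨ ℕ.+-monoʳ-≤ ⌊ r /2⌋ (ℕ.⌊n/2⌋≤⌈n/2⌉ r) ⟩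
  ⌊ r /2⌋ + ⌈ r /2⌉     ≡⟨ ℕ.⌊n/2⌋+⌈n/2⌉≡n r ⟩
  r                     <⟨ r<n+n ⟩
  n + n                 ∎)
  where open ℕ.≤-Reasoning

module Colored (q : ℕ) (c : Fin (suc q)) where

  open Melonic (_≟A_ {q} {c})

  Kept : Fin (suc q) → Set
  Kept i = T (okCol c i)

  kept? : ∀ i → Dec (Kept i)
  kept? i = T? (okCol c i)

  kept⇒≢0 : ∀ {i} → Kept i → i ≢ zero
  kept⇒≢0 {zero} ()
  kept⇒≢0 {suc i} _ ()

  kept⇒≢c : ∀ {i} → Kept i → i ≢ c
  kept⇒≢c {zero} ()
  kept⇒≢c {suc i} kept i≡c with suc i ≟F c
  ... | yes _ = kept
  ... | no i≢c = i≢c i≡c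

  ≢c⇒kept : ∀ i → suc i ≢ c → Kept (suc i)
  ≢c⇒kept i i≢c with suc i ≟F c
  ... | yes i≡c = i≢c i≡c
  ... | no _ = tt

  ColA-≡ : ∀ {x y : ColA q c} → proj₁ x ≡ proj₁ y → x ≡ y
  ColA-≡ {i , p} {.i , p′} refl rewrite T-irrelevant p p′ = refl

  module Matching {n : ℕ} (σ : Fin (suc q) → Fin n → Fin n) (σ-invol : ∀ i v → σ i (σ i v) ≡ v) where

    σ-injective : ∀ i → Injective _≡_ _≡_ (σ i)
    σ-injective i {x} {y} eq = trans (sym (σ-invol i x)) (trans (cong (σ i) eq) (σ-invol i y))

    π : Fin (suc q) → Fin n → Fin n
    π i x = σ zero (σ i x)

    π-injective : ∀ i → Injective _≡_ _≡_ (π i)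
    π-injective i eq = σ-injective i (σ-injective zero eq)

    module _ (i : Fin (suc q)) where
      open Orbits (π i) (π-injective i) public
        renaming (Orbit to SameCycle; orbit-sym to sameCycle-sym; orbit-trans to sameCycle-trans;
                  orbit? to sameCycle?)
        using ()

    _⇝_ : Fin n → Fin n → Set
    _⇝_ = Reach σ Kept

    ⇝-trans : ∀ {x y z} → x ⇝ y → y ⇝ z → x ⇝ z
    ⇝-trans x⇝y here          = x⇝y
    ⇝-trans x⇝y (step a p y⇝z) = step a p (⇝-trans x⇝y y⇝z)

    ⇝-extend : ∀ {x y z} i → Kept i → x ⇝ y → σ i y ≡ z → x ⇝ z
    ⇝-extend i kept x⇝y refl = step i kept x⇝y

    ⇝-sym : ∀ {x y} → x ⇝ y → y ⇝ x
    ⇝-sym here = here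
    ⇝-sym (step a p x⇝y) = ⇝-trans (⇝-extend a p here (σ-invol a _)) (⇝-sym x⇝y)

    Commutes : ∀ {m} → (ColA q c → Fin m → Fin m) → (Fin m → Fin n) → Set
    Commutes σ₀ f = ∀ a w → f (σ₀ a w) ≡ σ (proj₁ a) (f w)

    ImageIsComponentOf : ∀ {m} → Fin n → (Fin m → Fin n) → Set
    ImageIsComponentOf v f = ∀ u → v ⇝ u ⇔ (∃ λ w → f w ≡ u)

    MelonicComponent : Fin n → Set
    MelonicComponent v = Σ ℕ λ m → Σ (ColA q c → Fin m → Fin m) λ σ₀ → Built m σ₀ ×
      Σ (Fin m → Fin n) λ f → Injective _≡_ _≡_ f × Commutes σ₀ f × ImageIsComponentOf v f

    image-closed : ∀ {m} (σ₀ : ColA q c → Fin m → Fin m) {f} → Commutes σ₀ f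
                 → ∀ x {u} → f x ⇝ u → ∃ λ w → f w ≡ u
    image-closed σ₀ commutes x here = x , refl
    image-closed σ₀ commutes x (step a p fx⇝u) with image-closed σ₀ commutes x fx⇝u
    ... | w , refl = σ₀ (a , p) w , commutes (a , p) w

    melonic-⇝ : ∀ {u v} → u ⇝ v → MelonicComponent v → MelonicComponent u
    melonic-⇝ u⇝v (m , σ₀ , built , f , f-injective , commutes , image) =
      m , σ₀ , built , f , f-injective , commutes , λ w →
        mk⇔ (λ u⇝w → Equivalence.to (image w) (⇝-trans (⇝-sym u⇝v) u⇝w))
            (λ w∈f → ⇝-trans u⇝v (Equivalence.from (image w) w∈f))

    edgeMelonic : ∀ a {v y} → Kept a → y ≢ v → (∀ i → Kept i → σ i v ≡ y) → MelonicComponent v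
    edgeMelonic a {v} {y} kept y≢v σv≡y = 2 , (λ _ → swap2) , base , f , f-injective , commutes , image
      where
      f : Fin 2 → Fin n
      f zero       = v
      f (suc zero) = y

      f-injective : Injective _≡_ _≡_ f
      f-injective {zero}     {zero}     _  = refl
      f-injective {zero}     {suc zero} eq = ⊥-elim (y≢v (sym eq))
      f-injective {suc zero} {zero}     eq = ⊥-elim (y≢v eq)
      f-injective {suc zero} {suc zero} _  = refl

      commutes : Commutes (λ _ → swap2) f
      commutes (i , p) zero       = sym (σv≡y i p)
      commutes (i , p) (suc zero) = sym (trans (cong (σ i) (sym (σv≡y i p))) (σ-invol i v))

      image : ImageIsComponentOf v f
      image u = mk⇔ (image-closed (λ _ → swap2) commutes zero) λ
        { (zero , refl)     → here
        ; (suc zero , refl) → ⇝-extend a kept here (σv≡y a kept) }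

    -- The walk in S_ĉ through the white vertices b 0, b 1, … (named by their black end)
    -- and, between b t and b (suc t), the colour-(j t) vertex of S containing both.
    record WalkStep (black : Fin n → Bool) (b : ℕ → Fin n) (j : ℕ → Fin (suc q)) (t : ℕ) : Set where
      field
        kept    : Kept (j t)
        isBlack : black (b t) ≡ true
        along   : SameCycle (j t) (b t) (b (suc t))
        moves   : b (suc t) ≢ b t
        turns   : j (suc t) ≢ j t

    NoLongWalk : (Fin n → Bool) → Set
    NoLongWalk black = ∀ b j → ¬ (∀ t → t ≤ n → WalkStep black b j t)

  module _ (G : ColGraph q) (black : Fin (ColGraph.n G) → Bool) where
    open ColGraph G
    open Constellation G black using (SVert; wv; cv; SEq; SAdj; IsForest)
    open Matching σ invol

    SEq? : ∀ (x y : SVert c) → Dec (SEq x y)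
    SEq? (wv b _)         (wv b′ _)          = b ≟F b′
    SEq? (wv _ _)         (cv _ _ _ _ _)     = no λ ()
    SEq? (cv _ _ _ _ _)   (wv _ _)           = no λ ()
    SEq? (cv i _ _ b _)   (cv i′ _ _ b′ _) with i ≟F i′
    ... | no i≢i′ = no λ eq → i≢i′ (proj₁ eq)
    ... | yes refl with sameCycle? i b b′
    ...   | yes same = yes (refl , same)
    ...   | no ¬same = no λ eq → ¬same (proj₂ eq)

    SEq-sym : ∀ {x y : SVert c} → SEq x y → SEq y x
    SEq-sym {wv _ _}         {wv _ _}         eq          = sym eq
    SEq-sym {cv i _ _ _ _}   {cv _ _ _ _ _}   (refl , eq) = refl , sameCycle-sym i eq

    SAdj-resp-SEq : ∀ {x y z : SVert c} → SAdj x y → SEq y z → SAdj x z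
    SAdj-resp-SEq {wv _ _}       {cv i _ _ _ _} {cv _ _ _ _ _} adj (refl , eq) = sameCycle-trans i adj eq
    SAdj-resp-SEq {cv i _ _ _ _} {wv _ _}       {wv _ _}       adj refl        = adj

    open RepetitionCycle SEq SAdj SEq? SEq-sym SAdj-resp-SEq

    -- Position 2t of the walk is the white vertex of b t and position 2t+1 the colour-(j t)
    -- vertex; positions beyond n are clamped to n so that the walk is total.
    module WalkInS {b : ℕ → Fin n} {j : ℕ → Fin (suc q)} (steps : ∀ t → t ≤ n → WalkStep black b j t) where

      stepAt : ∀ t → WalkStep black b j (t ⊓ n)
      stepAt t = steps (t ⊓ n) (ℕ.m⊓n≤n t n)

      module _ {t} (t<n : t < n) where
        private
          unclamp : t ⊓ n ≡ t
          unclamp = ℕ.m≤n⇒m⊓n≡m (ℕ.<⇒≤ t<n)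
          unclamp-suc : suc t ⊓ n ≡ suc t
          unclamp-suc = ℕ.m≤n⇒m⊓n≡m t<n
          stepₜ : WalkStep black b j t
          stepₜ = steps t (ℕ.<⇒≤ t<n)

        alongAt : SameCycle (j (t ⊓ n)) (b (t ⊓ n)) (b (suc t ⊓ n))
        alongAt rewrite unclamp | unclamp-suc = WalkStep.along stepₜ

        movesAt : b (suc t ⊓ n) ≢ b (t ⊓ n)
        movesAt rewrite unclamp | unclamp-suc = WalkStep.moves stepₜ

        turnsAt : j (suc t ⊓ n) ≢ j (t ⊓ n)
        turnsAt rewrite unclamp | unclamp-suc = WalkStep.turns stepₜ

      vertexAt : Parity → ℕ → SVert c
      vertexAt 0ℙ t = wv (b (t ⊓ n)) (WalkStep.isBlack (stepAt t))
      vertexAt 1ℙ t = cv (j (t ⊓ n)) (kept⇒≢0 (WalkStep.kept (stepAt t))) (kept⇒≢c (WalkStep.kept (stepAt t)))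
                          (b (t ⊓ n)) (WalkStep.isBlack (stepAt t))

      walk : ℕ → SVert c
      walk r = vertexAt (parity r) ⌊ r /2⌋

      Consecutive : Parity → ℕ → Parity → ℕ → Set
      Consecutive p t p′ t′ = (p ≡ 0ℙ × p′ ≡ 1ℙ × t′ ≡ t) ⊎ (p ≡ 1ℙ × p′ ≡ 0ℙ × t′ ≡ suc t)

      adjacentAt : ∀ {p t p′ t′} → Consecutive p t p′ t′ → t < n → SAdj (vertexAt p t) (vertexAt p′ t′)
      adjacentAt (inj₁ (refl , refl , refl)) _ = 0 , refl
      adjacentAt {t = t} (inj₂ (refl , refl , refl)) t<n = sameCycle-sym (j (t ⊓ n)) (alongAt t<n)

      distinctAt : ∀ {p t p′ t′} → Consecutive p t p′ t′ → ¬ SEq (vertexAt p t) (vertexAt p′ t′)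
      distinctAt (inj₁ (refl , refl , refl)) ()
      distinctAt (inj₂ (refl , refl , refl)) ()

      backtrackAt : ∀ p {t} → t < n → ¬ SEq (vertexAt p t) (vertexAt p (suc t))
      backtrackAt 0ℙ t<n eq = movesAt t<n (sym eq)
      backtrackAt 1ℙ t<n eq = turnsAt t<n (sym (proj₁ eq))

      evenVertex : ∀ t → walk (t + t) ≡ vertexAt 0ℙ t
      evenVertex t = cong₂ vertexAt (parity-double t) (sym (ℕ.n≡⌊n+n/2⌋ t))

      walk-cycle : ∃ Cycle
      walk-cycle with pigeonhole (ℕ.n<1+n n) (λ (k : Fin (suc n)) → b (toℕ k ⊓ n))
      ... | s , t , s<t , eq =
        repeat⇒cycle walk (n + n)
          (λ r r<2n → adjacentAt (parity-⌊/2⌋-suc r) (⌊/2⌋<-double r<2n))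
          (λ r → distinctAt (parity-⌊/2⌋-suc r))
          (λ r r<2n → backtrackAt (parity r) (⌊/2⌋<-double r<2n))
          (ℕ.+-mono-< s<t s<t)
          (ℕ.+-mono-≤ t≤n t≤n)
          (subst₂ SEq (sym (evenVertex (toℕ s))) (sym (evenVertex (toℕ t))) eq)
        where
        t≤n : toℕ t ≤ n
        t≤n = ℕ.≤-pred (toℕ<n t)

    forest⇒noLongWalk : IsForest c → NoLongWalk black
    forest⇒noLongWalk forest b j steps =
      let m , cycle = WalkInS.walk-cycle steps in
      forest m (record { vtx = Cycle.vtx cycle ; distinct = Cycle.distinct cycle
                       ; adj = Cycle.adj cycle ; close = Cycle.close cycle })

  -- What of the hypotheses survives the removal of a melon: connectivity is dropped and the
  -- forest condition is weakened to the absence of long walks in S_ĉ.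
  record TreelikeGraph : Set where
    field
      n          : ℕ
      σ          : Fin (suc q) → Fin n → Fin n
      σ-invol    : ∀ i v → σ i (σ i v) ≡ v
      black      : Fin n → Bool
      bipartite  : ∀ i v → black (σ i v) ≡ not (black v)
    open Matching σ σ-invol public
    field
      noLongWalk : NoLongWalk black

  module Leaves (G : TreelikeGraph) where
    open TreelikeGraph G

    σ-loopless : ∀ i v → σ i v ≢ v
    σ-loopless i v eq = not-¬ (cong black eq) (bipartite i v)

    black-π : ∀ i x → black (π i x) ≡ black x
    black-π i x = trans (bipartite zero (σ i x)) (trans (cong not (bipartite i x)) (not-involutive (black x)))

    Active : Fin n → Set
    Active x = black x ≡ true × ∃ λ i → Kept i × π i x ≢ x

    active? : ∀ x → Dec (Active x)
    active? x = (black x ≟B true) ×-dec any? (λ i → kept? i ×-dec ¬? (π i x ≟F x))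

    activeSet : Subset n
    activeSet = tabulate (λ x → isYes (active? x))

    active⇒∈ : ∀ {x} → Active x → x ∈ activeSet
    active⇒∈ {x} act = lookup⇒[]= x activeSet
      (trans (lookup∘tabulate _ x) (Equivalence.to T-≡ (fromWitness {a? = active? x} act)))

    ∈⇒active : ∀ {x} → x ∈ activeSet → Active x
    ∈⇒active {x} x∈ = toWitness {a? = active? x}
      (Equivalence.from T-≡ (trans (sym (lookup∘tabulate _ x)) ([]=⇒lookup x∈)))

    inactive⇒fixed : ¬ ∃ Active → ∀ {i} → Kept i → ∀ {x} → black x ≡ true → π i x ≡ x
    inactive⇒fixed none {i} kept-i {x} black-x =
      decidable-stable (π i x ≟F x) λ moving → none (x , black-x , i , kept-i , moving)

    inactive⇒edge : ¬ ∃ Active → ∀ i → Kept i → ∀ v → σ i v ≡ σ zero v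
    inactive⇒edge none i kept-i v with black v ≟B true
    ... | yes black-v = σ-injective zero (trans (inactive⇒fixed none kept-i black-v) (sym (σ-invol zero v)))
    ... | no white-v  = trans (cong (σ i) (sym (σ-injective zero (inactive⇒fixed none kept-i black-σ₀v))))
                              (σ-invol i (σ zero v))
      where
      black-σ₀v : black (σ zero v) ≡ true
      black-σ₀v = trans (bipartite zero v) (cong not (¬-not white-v))

    -- In S_ĉ, every neighbour of the white vertex of `vertex` except the colour-`colour` one
    -- is a leaf.
    record Leaf : Set where
      field
        vertex  : Fin n
        colour  : Fin (suc q)
        isBlack : black vertex ≡ true
        kept    : Kept colour
        moving  : π colour vertex ≢ vertex
        fixed   : ∀ i → Kept i → i ≢ colour → π i vertex ≡ vertex

    record Position : Set where
      field
        vertex  : Fin n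
        colour  : Fin (suc q)
        isBlack : black vertex ≡ true
        kept    : Kept colour
        moving  : π colour vertex ≢ vertex
    open Position

    Exit : Position → Fin (suc q) → Set
    Exit s i = Kept i × i ≢ colour s × π i (vertex s) ≢ vertex s

    exit? : ∀ s → Dec (∃ (Exit s))
    exit? s = any? λ i → kept? i ×-dec ¬? (i ≟F colour s) ×-dec ¬? (π i (vertex s) ≟F vertex s)

    move : ∀ s i → Exit s i → Position
    move s i (kept , _ , moving) = record
      { vertex = π i (vertex s) ; colour = i ; isBlack = trans (black-π i (vertex s)) (isBlack s)
      ; kept = kept ; moving = λ eq → moving (π-injective i eq) }

    -- Abstract, as unfolding next under iter makes type checking of findLeaf blow up.
    abstract
      next : Position → Position
      next s with exit? s
      ... | yes (i , exit) = move s i exit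
      ... | no _           = s

      next-exits : ∀ s → ∃ (Exit s) → Exit s (colour (next s)) × vertex (next s) ≡ π (colour (next s)) (vertex s)
      next-exits s ∃exit with exit? s
      ... | yes (i , exit) = exit , refl
      ... | no stuck       = ⊥-elim (stuck ∃exit)

    stuck⇒leaf : ∀ s → ¬ ∃ (Exit s) → Leaf
    stuck⇒leaf s stuck = record
      { vertex = vertex s ; colour = colour s ; isBlack = isBlack s ; kept = kept s ; moving = moving s
      ; fixed = λ i kept i≢a → decidable-stable (π i (vertex s) ≟F vertex s) (λ moving → stuck (i , kept , i≢a , moving)) }

    -- As long as no position is stuck, the positions visited trace a walk in S_ĉ; since no walk
    -- is long, one of the first 2 + n positions is stuck.
    findLeaf : Position → Leaf
    findLeaf s₀ with any? (λ (t : Fin (2 + n)) → ¬? (exit? (iter next (toℕ t) s₀)))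
    ... | yes (t , stuck) = stuck⇒leaf (iter next (toℕ t) s₀) stuck
    ... | no never        = ⊥-elim (noLongWalk b j steps)
      where
      at : ℕ → Position
      at t = iter next t s₀

      b : ℕ → Fin n
      b t = vertex (at t)

      j : ℕ → Fin (suc q)
      j t = colour (at (suc t))

      exits : ∀ t → t < 2 + n → ∃ (Exit (at t))
      exits t t<2+n = decidable-stable (exit? (at t)) λ stuck →
        never (fromℕ< t<2+n , subst (λ t → ¬ ∃ (Exit (at t))) (sym (toℕ-fromℕ< t<2+n)) stuck)

      steps : ∀ t → t ≤ n → WalkStep black b j t
      steps t t≤n with next-exits (at t) (exits t (s≤s (ℕ.m≤n⇒m≤1+n t≤n)))
                     | next-exits (at (suc t)) (exits (suc t) (s≤s (s≤s t≤n)))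
      ... | (kept′ , _ , moving′) , moved | (_ , turned , _) , _ = record
        { kept    = kept′
        ; isBlack = isBlack (at t)
        ; along   = 1 , sym moved
        ; moves   = λ eq → moving′ (trans (sym moved) eq)
        ; turns   = turned
        }

    activeLeaf : ∀ {x} → Active x → Leaf
    activeLeaf {x} (isBlack , colour , kept , moving) =
      findLeaf (record { vertex = x ; colour = colour ; isBlack = isBlack ; kept = kept ; moving = moving })

  -- For i ∈ A ∖ {a}, σ i b = w; on colour a, the edges {b, σ a b}, {w, σ a w} are replaced
  -- by {b, w}, {σ a b, σ a w}. Each cycle of π′ lies within one of π, so S_ĉ gains no walks.
  module RemoveLeaf (G : TreelikeGraph) (leaf : Leaves.Leaf G) where
    open TreelikeGraph G
    open Leaves G using (Active; σ-loopless; activeSet; active⇒∈)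
    open Leaves.Leaf leaf renaming (vertex to b; colour to a; kept to kept-a; isBlack to black-b)

    w : Fin n
    w = σ zero b

    w≢σab : w ≢ σ a b
    w≢σab eq = moving (trans (cong (σ zero) (sym eq)) (σ-invol zero b))

    b≢σaw : b ≢ σ a w
    b≢σaw eq = w≢σab (trans (sym (σ-invol a w)) (cong (σ a) (sym eq)))

    σb : ∀ {i} → Kept i → i ≢ a → σ i b ≡ w
    σb {i} kept-i i≢a = trans (sym (σ-invol zero (σ i b))) (cong (σ zero) (fixed i kept-i i≢a))

    σw : ∀ {i} → Kept i → i ≢ a → σ i w ≡ b
    σw {i} kept-i i≢a = trans (cong (σ i) (sym (σb kept-i i≢a))) (σ-invol i b)

    a≢0 : a ≢ zero
    a≢0 = kept⇒≢0 kept-a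

    open Rewire (σ a) (σ-invol a) b w
                (λ eq → σ-loopless zero b (sym eq)) (λ eq → σ-loopless a b (sym eq))
                (λ eq → σ-loopless a w (sym eq)) b≢σaw

    σ′ : Fin (suc q) → Fin n → Fin n
    σ′ i with i ≟F a
    ... | yes _ = rewire
    ... | no _  = σ i

    σ′-a : ∀ v → σ′ a v ≡ rewire v
    σ′-a v with a ≟F a
    ... | yes _   = refl
    ... | no a≢a  = ⊥-elim (a≢a refl)

    σ′-≢ : ∀ {i} → i ≢ a → ∀ v → σ′ i v ≡ σ i v
    σ′-≢ {i} i≢a v with i ≟F a
    ... | yes i≡a = ⊥-elim (i≢a i≡a)
    ... | no _    = refl

    σ′-invol : ∀ i v → σ′ i (σ′ i v) ≡ v
    σ′-invol i v with i ≟F a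
    ... | yes _ = rewire-invol v
    ... | no _  = σ-invol i v

    bipartite′ : ∀ i v → black (σ′ i v) ≡ not (black v)
    bipartite′ i v with i ≟F a
    ... | yes _ = rewire-flips black (bipartite a) (bipartite zero b) v
    ... | no _  = bipartite i v

    σ′-other : ∀ i {z} → Other z → σ′ i z ≡ σ i z
    σ′-other i {z} o with i ≟F a
    ... | yes refl = rewire-other o
    ... | no _     = refl

    module M′ = Matching σ′ σ′-invol

    π′≡ : ∀ i z → M′.π i z ≡ σ zero (σ′ i z)
    π′≡ i z = σ′-≢ (λ 0≡a → a≢0 (sym 0≡a)) (σ′ i z)

    π′-≢ : ∀ {i} → i ≢ a → ∀ z → M′.π i z ≡ π i z
    π′-≢ {i} i≢a z = trans (π′≡ i z) (cong (σ zero) (σ′-≢ i≢a z))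

    π′-a : ∀ z → M′.π a z ≡ σ zero (rewire z)
    π′-a z = trans (π′≡ a z) (cong (σ zero) (σ′-a z))

    π′-a-b : M′.π a b ≡ b
    π′-a-b = trans (π′-a b) (trans (cong (σ zero) rewire-x) (σ-invol zero b))

    -- Case splits on this rather than on i ≟F a, which would also rewrite the σ′ i hidden in
    -- hypotheses about M′.π i.
    ≡a⊎≢a : ∀ i → i ≡ a ⊎ i ≢ a
    ≡a⊎≢a i with i ≟F a
    ... | yes i≡a = inj₁ i≡a
    ... | no i≢a  = inj₂ i≢a

    π-σaw : π a (σ a w) ≡ b
    π-σaw = trans (cong (σ zero) (σ-invol a w)) (σ-invol zero b)

    π′-step : ∀ i z → SameCycle i z (M′.π i z)
    π′-step i z rewrite π′≡ i z with i ≟F a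
    ... | no _    = 1 , refl
    ... | yes refl with case z
    ...   | is-x z≡b = 0 , trans z≡b (sym (σ-invol zero b))
    ...   | is-y z≡w = 0 , z≡w
    ...   | is-τx refl = 2 , cong (π a) (cong (σ zero) (σ-invol a b))
    ...   | is-τy refl = 2 , cong (π a) π-σaw
    ...   | other _    = 1 , refl

    sameCycle′⇒sameCycle : ∀ i {x y} → M′.SameCycle i x y → SameCycle i x y
    sameCycle′⇒sameCycle i {x} (k , refl) = iterates k
      where
      iterates : ∀ k → SameCycle i x (iter (M′.π i) k x)
      iterates zero    = 0 , refl
      iterates (suc k) = sameCycle-trans i (iterates k) (π′-step i _)

    noLongWalk′ : M′.NoLongWalk black
    noLongWalk′ bs js steps = noLongWalk bs js λ t t≤n → let open M′.WalkStep (steps t t≤n) in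
      record { kept = kept ; isBlack = isBlack ; along = sameCycle′⇒sameCycle (js t) along
             ; moves = moves ; turns = turns }

    reduced : TreelikeGraph
    reduced = record { n = n ; σ = σ′ ; σ-invol = σ′-invol ; black = black ; bipartite = bipartite′
                     ; noLongWalk = noLongWalk′ }

    open Leaves reduced using () renaming (Active to Active′; activeSet to activeSet′; ∈⇒active to ∈⇒active′)

    active′⇒active : ∀ x → Active′ x → Active x
    active′⇒active x (black-x , i , kept-i , moving′) with ≡a⊎≢a i
    ... | inj₂ i≢a = black-x , i , kept-i , λ fixed → moving′ (trans (π′-≢ i≢a x) fixed)
    ... | inj₁ refl with case x
    ...   | is-x refl  = ⊥-elim (moving′ π′-a-b)
    ...   | is-y refl  = ⊥-elim (not-¬ black-x (trans (bipartite zero b) (cong not black-b)))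
    ...   | is-τx refl = ⊥-elim (not-¬ black-x (trans (bipartite a b) (cong not black-b)))
    ...   | is-τy refl = black-x , a , kept-a , λ fixed → b≢σaw (trans (sym π-σaw) fixed)
    ...   | other o    = black-x , a , kept-a , λ fixed →
                           moving′ (trans (π′-a x) (trans (cong (σ zero) (rewire-other o)) fixed))

    leaf-active : Active b
    leaf-active = black-b , a , kept-a , moving

    leaf-inactive′ : ¬ Active′ b
    leaf-inactive′ (_ , i , kept-i , moving′) with ≡a⊎≢a i
    ... | inj₂ i≢a  = moving′ (trans (π′-≢ i≢a b) (fixed i kept-i i≢a))
    ... | inj₁ refl = moving′ π′-a-b

    fewerActive : ∣ activeSet′ ∣ < ∣ activeSet ∣
    fewerActive = p⊂q⇒∣p∣<∣q∣
      ( (λ x∈ → active⇒∈ (active′⇒active _ (∈⇒active′ x∈)))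
      , b , active⇒∈ leaf-active , λ b∈ → leaf-inactive′ (∈⇒active′ b∈) )

    module Lift (i₀ : Fin (suc q)) (kept₀ : Kept i₀) (i₀≢a : i₀ ≢ a)
                (melonic′ : ∀ v → M′.MelonicComponent v) where

      b⇝w : b ⇝ w
      b⇝w = ⇝-extend i₀ kept₀ here (σb kept₀ i₀≢a)

      σ′-edge : ∀ i → Kept i → ∀ z → z ⇝ σ′ i z
      σ′-edge i kept-i z with i ≟F a
      ... | no _    = step i kept-i here
      ... | yes refl with case z
      ...   | is-x refl  = b⇝w
      ...   | is-y refl  = ⇝-sym b⇝w
      ...   | is-τx refl = ⇝-extend a kept-a (⇝-trans (⇝-extend a kept-a here (σ-invol a b)) b⇝w) refl
      ...   | is-τy refl = ⇝-extend a kept-a (⇝-trans (⇝-extend a kept-a here (σ-invol a w)) (⇝-sym b⇝w)) refl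
      ...   | other _    = step a kept-a here

      ⇝′⇒⇝ : ∀ {x y} → x M′.⇝ y → x ⇝ y
      ⇝′⇒⇝ here                 = here
      ⇝′⇒⇝ (step i kept-i x⇝′y) = ⇝-trans (⇝′⇒⇝ x⇝′y) (σ′-edge i kept-i _)

      IsBW : Fin n → Set
      IsBW x = x ≡ b ⊎ x ≡ w

      bw-closed′ : ∀ {x y} → x M′.⇝ y → IsBW x → IsBW y
      bw-closed′ here bw = bw
      bw-closed′ (step {z} i kept-i x⇝′z) bw with bw-closed′ x⇝′z bw | i ≟F a
      ... | inj₁ refl | yes _  = inj₂ rewire-x
      ... | inj₂ refl | yes _  = inj₁ rewire-y
      ... | inj₁ refl | no i≢a = inj₂ (σb kept-i i≢a)
      ... | inj₂ refl | no i≢a = inj₁ (σw kept-i i≢a)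

      bw-component′ : ∀ {x y} → x M′.⇝ y → IsBW y → IsBW x
      bw-component′ x⇝′y = bw-closed′ (M′.⇝-sym x⇝′y)

      σab-not-bw : ¬ IsBW (σ a b)
      σab-not-bw (inj₁ σab≡b) = σ-loopless a b σab≡b
      σab-not-bw (inj₂ σab≡w) = w≢σab (sym σab≡w)

      -- The component of b in G is the component of σ a b in the reduced graph with the
      -- melon {b, w} inserted on its a-edge {σ a b, σ a w}.
      module Insertion {m} {σ₀ : ColA q c → Fin m → Fin m} {f : Fin m → Fin n}
                       (f-injective : Injective _≡_ _≡_ f) (commutes : M′.Commutes σ₀ f)
                       (image : M′.ImageIsComponentOf (σ a b) f) where

        a′ : ColA q c
        a′ = a , kept-a

        a′-≢ : ∀ {a″ : ColA q c} → a″ ≢ a′ → proj₁ a″ ≢ a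
        a′-≢ a″≢a′ eq = a″≢a′ (ColA-≡ eq)

        u₀ : Fin m
        u₀ = proj₁ (Equivalence.to (image (σ a b)) here)

        f-u₀ : f u₀ ≡ σ a b
        f-u₀ = proj₂ (Equivalence.to (image (σ a b)) here)

        f-σ₀u₀ : f (σ₀ a′ u₀) ≡ σ a w
        f-σ₀u₀ = trans (commutes a′ u₀) (trans (σ′-a (f u₀)) (trans (cong rewire f-u₀) rewire-τx))

        f-not-bw : ∀ x → ¬ IsBW (f x)
        f-not-bw x bw = σab-not-bw (bw-component′ (Equivalence.from (image (f x)) (x , refl)) bw)

        f′ : Fin (2 + m) → Fin n
        f′ zero          = b
        f′ (suc zero)    = w
        f′ (suc (suc x)) = f x

        f′-injective : Injective _≡_ _≡_ f′
        f′-injective {zero}          {zero}          _  = refl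
        f′-injective {zero}          {suc zero}      eq = ⊥-elim (σ-loopless zero b (sym eq))
        f′-injective {zero}          {suc (suc y)}   eq = ⊥-elim (f-not-bw y (inj₁ (sym eq)))
        f′-injective {suc zero}      {zero}          eq = ⊥-elim (σ-loopless zero b eq)
        f′-injective {suc zero}      {suc zero}      _  = refl
        f′-injective {suc zero}      {suc (suc y)}   eq = ⊥-elim (f-not-bw y (inj₂ (sym eq)))
        f′-injective {suc (suc x)}   {zero}          eq = ⊥-elim (f-not-bw x (inj₁ eq))
        f′-injective {suc (suc x)}   {suc zero}      eq = ⊥-elim (f-not-bw x (inj₂ eq))
        f′-injective {suc (suc x)}   {suc (suc y)}   eq = cong (λ z → suc (suc z)) (f-injective eq)

        f′-commutes : Commutes (insert σ₀ a′ u₀) f′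
        f′-commutes a″ zero with a″ ≟A a′
        ... | yes refl  = f-u₀
        ... | no a″≢a′ = sym (σb (proj₂ a″) (a′-≢ a″≢a′))
        f′-commutes a″ (suc zero) with a″ ≟A a′
        ... | yes refl  = f-σ₀u₀
        ... | no a″≢a′ = sym (σw (proj₂ a″) (a′-≢ a″≢a′))
        f′-commutes a″ (suc (suc x)) with a″ ≟A a′
        ... | no a″≢a′ = trans (commutes a″ x) (σ′-≢ (a′-≢ a″≢a′) (f x))
        ... | yes refl with x ≟F u₀
        ...   | yes refl = sym (trans (cong (σ a) f-u₀) (σ-invol a b))
        ...   | no x≢u₀ with x ≟F σ₀ a′ u₀
        ...     | yes refl = sym (trans (cong (σ a) f-σ₀u₀) (σ-invol a w))
        ...     | no x≢σ₀u₀ = trans (commutes a′ x) (trans (σ′-a (f x)) (rewire-other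
                    ( (λ eq → f-not-bw x (inj₁ eq)) , (λ eq → f-not-bw x (inj₂ eq))
                    , (λ eq → x≢u₀ (f-injective (trans eq (sym f-u₀))))
                    , (λ eq → x≢σ₀u₀ (f-injective (trans eq (sym f-σ₀u₀)))) )))

        f′-image : ImageIsComponentOf b f′
        f′-image u = mk⇔ (image-closed (insert σ₀ a′ u₀) f′-commutes zero) λ
          { (zero , refl)          → here
          ; (suc zero , refl)      → b⇝w
          ; (suc (suc x) , refl)   → ⇝-trans (step a kept-a here) (⇝′⇒⇝ (Equivalence.from (image (f x)) (x , refl))) }

      melonic-leaf : MelonicComponent b
      melonic-leaf with melonic′ (σ a b)
      ... | m , σ₀ , built , f , f-injective , commutes , image =
        2 + m , insert σ₀ a′ u₀ , grow built a′ u₀ , f′ , f′-injective , f′-commutes , f′-image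
        where open Insertion f-injective commutes image

      -- Components of the reduced graph avoiding the four rewired vertices are components of G.
      module Untouched {v} (v-not-bw : ¬ IsBW v) {m} {σ₀ : ColA q c → Fin m → Fin m} {f : Fin m → Fin n}
                       (commutes : M′.Commutes σ₀ f) (image : M′.ImageIsComponentOf v f)
                       (misses : ∀ x → ¬ (f x ≡ σ a b ⊎ f x ≡ σ a w)) where

        f-other : ∀ x → Other (f x)
        f-other x = (λ eq → v-not-bw (bw-component′ v⇝′fx (inj₁ eq)))
                  , (λ eq → v-not-bw (bw-component′ v⇝′fx (inj₂ eq)))
                  , (λ eq → misses x (inj₁ eq)) , (λ eq → misses x (inj₂ eq))
          where v⇝′fx = Equivalence.from (image (f x)) (x , refl)

        f-commutes : Commutes σ₀ f
        f-commutes a″ x = trans (commutes a″ x) (σ′-other (proj₁ a″) (f-other x))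

        f-image : ImageIsComponentOf v f
        f-image u = mk⇔
          (λ v⇝u → let x₀ , fx₀≡v = Equivalence.to (image v) here in
                   image-closed σ₀ f-commutes x₀ (subst (_⇝ u) (sym fx₀≡v) v⇝u))
          (λ hit → ⇝′⇒⇝ (Equivalence.from (image u) hit))

      rewired⇝b : ∀ {x} → x ≡ σ a b ⊎ x ≡ σ a w → x ⇝ b
      rewired⇝b (inj₁ refl) = ⇝-extend a kept-a here (σ-invol a b)
      rewired⇝b (inj₂ refl) = ⇝-trans (⇝-extend a kept-a here (σ-invol a w)) (⇝-sym b⇝w)

      melonic : ∀ v → MelonicComponent v
      melonic v with v ≟F b | v ≟F w
      ... | yes refl | _        = melonic-leaf
      ... | no _     | yes refl = melonic-⇝ (⇝-sym b⇝w) melonic-leaf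
      ... | no v≢b   | no v≢w   with melonic′ v
      ...   | m , σ₀ , built , f , f-injective , commutes , image
              with any? (λ x → (f x ≟F σ a b) ⊎-dec (f x ≟F σ a w))
      ...     | yes (x , hit) =
                  melonic-⇝ (⇝-trans (⇝′⇒⇝ (Equivalence.from (image (f x)) (x , refl))) (rewired⇝b hit))
                            melonic-leaf
      ...     | no miss = m , σ₀ , built , f , f-injective , f-commutes , f-image
        where
        open Untouched [ v≢b , v≢w ] commutes image (λ x hit → miss (x , hit))

  module Induction (a₀ a₁ : Fin (suc q)) (kept₀ : Kept a₀) (kept₁ : Kept a₁) (a₀≢a₁ : a₀ ≢ a₁) where

    otherKept : ∀ a → ∃ λ i → Kept i × i ≢ a
    otherKept a with a₀ ≟F a
    ... | yes refl = a₁ , kept₁ , λ eq → a₀≢a₁ (sym eq)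
    ... | no a₀≢a  = a₀ , kept₀ , a₀≢a

    allMelonic : ∀ N (G : TreelikeGraph) → ∣ Leaves.activeSet G ∣ < N → ∀ v → TreelikeGraph.MelonicComponent G v
    allMelonic (suc N) G bound v with any? (Leaves.active? G)
    ... | no none = edgeMelonic a₀ kept₀ (σ-loopless zero v) (λ i kept-i → inactive⇒edge none i kept-i v)
      where open TreelikeGraph G
            open Leaves G
    ... | yes (_ , active) with otherKept (Leaves.Leaf.colour (Leaves.activeLeaf G active))
    ...   | i₀ , kept-i₀ , i₀≢a =
      Lift.melonic i₀ kept-i₀ i₀≢a (allMelonic N reduced (ℕ.<-≤-trans fewerActive (ℕ.≤-pred bound))) v
      where open RemoveLeaf G (Leaves.activeLeaf G active)

  module _ (G : ColGraph q) (black : Fin (ColGraph.n G) → Bool) (bipartite : IsBipartite G black)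
           (forest : Constellation.IsForest G black c) where
    open ColGraph G
    open Matching σ invol using (edgeMelonic)

    treelike : TreelikeGraph
    treelike = record { n = n ; σ = σ ; σ-invol = invol ; black = black ; bipartite = bipartite
                      ; noLongWalk = forest⇒noLongWalk G black forest }

    componentMelonic : ∀ a₀ → Kept a₀ → ∀ v → ComponentMelonic G c v
    componentMelonic a₀ kept₀ v with any? (λ i → kept? i ×-dec ¬? (i ≟F a₀))
    ... | yes (a₁ , kept₁ , a₁≢a₀) =
      Induction.allMelonic a₀ a₁ kept₀ kept₁ (λ eq → a₁≢a₀ (sym eq)) _ treelike (ℕ.n<1+n _) v
    ... | no onlyA₀ = edgeMelonic a₀ kept₀ (loopless a₀ v) λ i kept-i →
      cong (λ j → σ j v) (decidable-stable (i ≟F a₀) λ i≢a₀ → onlyA₀ (i , kept-i , i≢a₀))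

keptColour : ∀ {q} → 2 ≤ q → (c : Fin (suc q)) → ∃ λ i → T (okCol c i)
keptColour {suc zero} (s≤s ()) c
keptColour {suc (suc q)} _ c with suc zero ≟F c
... | no 1≢c  = suc zero , Colored.≢c⇒kept _ c zero 1≢c
... | yes 1≡c = suc (suc zero) , Colored.≢c⇒kept _ c (suc zero) λ 2≡c → 1≢2 (trans 1≡c (sym 2≡c))
  where
  1≢2 : suc {suc (suc q)} zero ≢ suc (suc zero)
  1≢2 ()

lemma5p5 : (q : ℕ) → 2 ≤ q → (G : ColGraph q) → (root : Fin (ColGraph.n G))
    → (black : Fin (ColGraph.n G) → Bool) → IsBipartite G black
    → (c : Fin (suc q)) → c ≢ zero → Constellation.IsForest G black c
    → ∀ v → ComponentMelonic G c v
lemma5p5 q 2≤q G root black bipartite c c≢0 forest v =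
  Colored.componentMelonic q c G black bipartite forest (proj₁ (keptColour 2≤q c)) (proj₂ (keptColour 2≤q c)) v
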